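{- The subtyping relation $\preceq$ satisfies the following properties (all types mentioned are assumed well formed; in particular the domain of any arrow type is a qubit type, and $\Psi_1,\Psi_2,\Psi_3,\Psi_4$ denote qubit types): \begin{enumerate} \item If $A \Rightarrow B \preceq C \Rightarrow D$, then $C \preceq A$ and $B \preceq D$. \item If $A \Rightarrow B \preceq S(C \Rightarrow D)$, then $C \preceq A$ and $B \preceq D$. \item If $S(A) \preceq B$, then there is a type $C$ with $B \approx S(C)$ and $A \preceq C$. \item If $\Psi_1 \times \Psi_2 \preceq A$, then there are qubit types $\Psi_3,\Psi_4$ with $A \approx S(\Psi_3 \times \Psi_4)$ or $A \approx \Psi_3 \times \Psi_4$. \item If $A \preceq B$, then $A$ and $B$ contain the same number of product constructors $\times$. \item If $A \preceq \Psi_1 \Rightarrow C$, then $A \approx \Psi_2 \Rightarrow D$ for some qubit type $\Psi_2$ and type $D$. \item If $S(A) \preceq S(\Psi_1 \Rightarrow C)$, then $S(A) \approx S(\Psi_2 \Rightarrow D)$ for some qubit type $\Psi_2$ and type $D$. \item If $S(\Psi_1 \Rightarrow A) \preceq S(\Psi_2 \Rightarrow B)$, then $\Psi_2 \preceq \Psi_1$ and $A \preceq B$. \end{enumerate}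
   Context: Types are given by the grammar: atomic types $\mathbb{A} ::= \mathbb{B} \mid \mathbb{X}$; base types $M ::= \mathbb{A} \mid M \times M$; qubit types $\Psi ::= M \mid S(\Psi) \mid \Psi \times \Psi$; types $A ::= \Psi \mid \Psi \Rightarrow A \mid S(A)$. Products are considered modulo associativity, and $\prod_{i=0}^n \Psi_i$ denotes $\Psi_0 \times \dots \times \Psi_n$. The subtyping relation $\preceq$ is the least relation closed under the rules: $A \preceq A$; if $A \preceq B$ and $B \preceq C$ then $A \preceq C$; $A \preceq S(A)$; $S(S(A)) \preceq S(A)$; for atomic types $\mathbb{A}_i,\mathbb{A}'_i$, $\prod_{i=0}^n \mathbb{A}_i \preceq S(\prod_{i=0}^n \mathbb{A}'_i)$; if $A \preceq B$ then $S(A) \preceq S(B)$; if $A \preceq B$ and $\Psi_1 \preceq \Psi_2$ (qubit types) then $\Psi_2 \Rightarrow A \preceq \Psi_1 \Rightarrow B$; if $\Psi_1 \preceq \Psi_2$ and $\Psi_3 \preceq \Psi_4$ (qubit types) then $\Psi_1 \times \Psi_3 \preceq \Psi_2 \times \Psi_4$. We write $A \approx B$ when $A \preceq B$ and $B \preceq A$. -}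

module Defs where

open import Data.Nat using (ℕ; zero; suc; _+_)
open import Data.Vec using (Vec; []; _∷_)
open import Data.Product using (_×_)

data Atom : Set where
  𝔹 𝕏 : Atom

-- Raw type syntax; well-formedness is a separate predicate below.
infixr 6 _⊗_
infixr 5 _⇒_
data Ty : Set where
  at  : Atom → Ty
  𝕊   : Ty → Ty
  _⊗_ : Ty → Ty → Ty
  _⇒_ : Ty → Ty → Ty

data IsBase : Ty → Set where
  base-at : ∀ a → IsBase (at a)
  base-⊗  : ∀ {M N} → IsBase M → IsBase N → IsBase (M ⊗ N)

data IsQubit : Ty → Set where
  q-base : ∀ {M} → IsBase M → IsQubit M
  q-S    : ∀ {Ψ} → IsQubit Ψ → IsQubit (𝕊 Ψ)
  q-⊗    : ∀ {Ψ Φ} → IsQubit Ψ → IsQubit Φ → IsQubit (Ψ ⊗ Φ)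

data IsType : Ty → Set where
  t-q : ∀ {Ψ} → IsQubit Ψ → IsType Ψ
  t-⇒ : ∀ {Ψ A} → IsQubit Ψ → IsType A → IsType (Ψ ⇒ A)
  t-S : ∀ {A} → IsType A → IsType (𝕊 A)

-- ∏_{i=0}^n 𝔸_i (right-nested; nesting is irrelevant modulo associativity)
∏ : ∀ {n} → Vec Atom (suc n) → Ty
∏ (a ∷ []) = at a
∏ (a ∷ b ∷ as) = at a ⊗ ∏ (b ∷ as)

-- Products modulo associativity are handled by the two
-- associativity rules (propagated to all contexts by the congruence rules
-- and transitivity). The middle type of transitivity is required to be
-- well formed, so that the relation on well-formed types is exactly the
-- least relation on (well-formed) types closed under the paper's rules.
infix 4 _≼_
data _≼_ : Ty → Ty → Set where
  ≼-refl   : ∀ {A} → A ≼ A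
  ≼-trans  : ∀ {A B C} → IsType B → A ≼ B → B ≼ C → A ≼ C
  ≼-S      : ∀ {A} → A ≼ 𝕊 A
  ≼-SS     : ∀ {A} → 𝕊 (𝕊 A) ≼ 𝕊 A
  ≼-atoms  : ∀ {n} (as bs : Vec Atom (suc n)) → ∏ as ≼ 𝕊 (∏ bs)
  ≼-cong-S : ∀ {A B} → A ≼ B → 𝕊 A ≼ 𝕊 B
  ≼-⇒      : ∀ {A B Ψ₁ Ψ₂} → IsQubit Ψ₁ → IsQubit Ψ₂ →
             A ≼ B → Ψ₁ ≼ Ψ₂ → (Ψ₂ ⇒ A) ≼ (Ψ₁ ⇒ B)
  ≼-⊗      : ∀ {Ψ₁ Ψ₂ Ψ₃ Ψ₄} → IsQubit Ψ₁ → IsQubit Ψ₂ → IsQubit Ψ₃ → IsQubit Ψ₄ →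
             Ψ₁ ≼ Ψ₂ → Ψ₃ ≼ Ψ₄ → (Ψ₁ ⊗ Ψ₃) ≼ (Ψ₂ ⊗ Ψ₄)
  ≼-assocˡ : ∀ {A B C} → A ⊗ (B ⊗ C) ≼ (A ⊗ B) ⊗ C
  ≼-assocʳ : ∀ {A B C} → (A ⊗ B) ⊗ C ≼ A ⊗ (B ⊗ C)

infix 4 _≈_
_≈_ : Ty → Ty → Set
A ≈ B = (A ≼ B) × (B ≼ A)

#× : Ty → ℕ
#× (at a)  = 0
#× (𝕊 A)   = #× A
#× (A ⊗ B) = suc (#× A + #× B)
#× (A ⇒ B) = #× A + #× B

{-# OPTIONS --safe #-}
-- Every rule carries "an arrow under finitely many 𝕊" on its left side to the
-- same shape on its right side and conversely, "a product under finitely many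
-- 𝕊" forwards, and a leading 𝕊 forwards. Only the arrow rule changes domain and
-- codomain, contravariantly and covariantly; transitivity composes these
-- changes, which needs well-formedness of its middle type. Under one more 𝕊 a
-- stack of 𝕊's collapses up to ≈, by ≼-S and ≼-SS.
module Submission where

open import Defs
open import Data.Empty using (⊥; ⊥-elim)
open import Data.Nat using (suc; _+_)
open import Data.Nat.Properties using (+-suc; +-assoc)
open import Data.Product using (_×_; Σ; ∃; ∃₂; _,_; proj₁; proj₂)
open import Data.Sum using (_⊎_; inj₁; inj₂)
open import Data.Vec using (Vec; []; _∷_)
open import Relation.Binary.PropositionalEquality
  using (_≡_; refl; cong; cong₂; sym; trans; module ≡-Reasoning)

data Iter𝕊 (T : Ty) : Ty → Set where
  𝕊⁰ : Iter𝕊 T T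
  𝕊⁺ : ∀ {P} → Iter𝕊 T P → Iter𝕊 T (𝕊 P)

IsType-𝕊⁻ : ∀ {A} → IsType (𝕊 A) → IsType A
IsType-𝕊⁻ (t-q (q-base ()))
IsType-𝕊⁻ (t-q (q-S q)) = t-q q
IsType-𝕊⁻ (t-S t)       = t

IsType-⇒⁻ : ∀ {A B} → IsType (A ⇒ B) → IsQubit A × IsType B
IsType-⇒⁻ (t-q (q-base ()))
IsType-⇒⁻ (t-⇒ q t) = q , t

IsType-⊗⁻ : ∀ {A B} → IsType (A ⊗ B) → IsQubit A × IsQubit B
IsType-⊗⁻ (t-q (q-base (base-⊗ m n))) = q-base m , q-base n
IsType-⊗⁻ (t-q (q-⊗ q r))             = q , r

IsType-Iter𝕊⁻ : ∀ {T P} → Iter𝕊 T P → IsType P → IsType T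
IsType-Iter𝕊⁻ 𝕊⁰     w = w
IsType-Iter𝕊⁻ (𝕊⁺ s) w = IsType-Iter𝕊⁻ s (IsType-𝕊⁻ w)

∏-≢-Iter𝕊⇒ : ∀ {n A B} (as : Vec Atom (suc n)) → Iter𝕊 (A ⇒ B) (∏ as) → ⊥
∏-≢-Iter𝕊⇒ (a ∷ [])     ()
∏-≢-Iter𝕊⇒ (a ∷ b ∷ as) ()

∏-Iter𝕊⊗ : ∀ {n A B} (as bs : Vec Atom (suc n)) → Iter𝕊 (A ⊗ B) (∏ as) →
           ∃₂ λ A′ B′ → Iter𝕊 (A′ ⊗ B′) (∏ bs)
∏-Iter𝕊⊗ (a ∷ [])     (c ∷ [])     ()
∏-Iter𝕊⊗ (a ∷ b ∷ as) (c ∷ d ∷ bs) _ = _ , _ , 𝕊⁰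

𝕊-Iter𝕊-≈ : ∀ {T P} → Iter𝕊 T P → IsType (𝕊 P) → 𝕊 P ≈ 𝕊 T
𝕊-Iter𝕊-≈ 𝕊⁰     _ = ≼-refl , ≼-refl
𝕊-Iter𝕊-≈ (𝕊⁺ s) w with 𝕊-Iter𝕊-≈ s (IsType-𝕊⁻ w)
... | P≼T , T≼P = ≼-trans (IsType-𝕊⁻ w) ≼-SS P≼T , ≼-trans (IsType-𝕊⁻ w) T≼P ≼-S

≼-preserves-Iter𝕊⇒ : ∀ {P X A B} → IsType X → P ≼ X → Iter𝕊 (A ⇒ B) P →
  ∃₂ λ A′ B′ → Iter𝕊 (A′ ⇒ B′) X × (A′ ≼ A) × (B ≼ B′)
≼-preserves-Iter𝕊⇒ _ ≼-refl s = _ , _ , s , ≼-refl , ≼-refl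
≼-preserves-Iter𝕊⇒ wx (≼-trans wm P≼M M≼X) s
  with ≼-preserves-Iter𝕊⇒ wm P≼M s
... | _ , _ , sM , A₁≼A , B≼B₁
  with ≼-preserves-Iter𝕊⇒ wx M≼X sM | IsType-⇒⁻ (IsType-Iter𝕊⁻ sM wm)
... | _ , _ , sX , A₂≼A₁ , B₁≼B₂ | qA₁ , tB₁ =
  _ , _ , sX , ≼-trans (t-q qA₁) A₂≼A₁ A₁≼A , ≼-trans tB₁ B≼B₁ B₁≼B₂
≼-preserves-Iter𝕊⇒ _ ≼-S s = _ , _ , 𝕊⁺ s , ≼-refl , ≼-refl
≼-preserves-Iter𝕊⇒ _ ≼-SS (𝕊⁺ (𝕊⁺ s)) = _ , _ , 𝕊⁺ s , ≼-refl , ≼-refl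
≼-preserves-Iter𝕊⇒ _ (≼-atoms as _) s = ⊥-elim (∏-≢-Iter𝕊⇒ as s)
≼-preserves-Iter𝕊⇒ wx (≼-cong-S P≼X) (𝕊⁺ s)
  with ≼-preserves-Iter𝕊⇒ (IsType-𝕊⁻ wx) P≼X s
... | _ , _ , sX , A′≼A , B≼B′ = _ , _ , 𝕊⁺ sX , A′≼A , B≼B′
≼-preserves-Iter𝕊⇒ _ (≼-⇒ _ _ B≼B′ A′≼A) 𝕊⁰ = _ , _ , 𝕊⁰ , A′≼A , B≼B′

≼-reflects-Iter𝕊⇒ : ∀ {P X C D} → P ≼ X → Iter𝕊 (C ⇒ D) X →
  ∃₂ λ C′ D′ → Iter𝕊 (C′ ⇒ D′) P
≼-reflects-Iter𝕊⇒ ≼-refl s = _ , _ , s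
≼-reflects-Iter𝕊⇒ (≼-trans _ P≼M M≼X) s with ≼-reflects-Iter𝕊⇒ M≼X s
... | _ , _ , sM = ≼-reflects-Iter𝕊⇒ P≼M sM
≼-reflects-Iter𝕊⇒ ≼-S (𝕊⁺ s) = _ , _ , s
≼-reflects-Iter𝕊⇒ ≼-SS (𝕊⁺ s) = _ , _ , 𝕊⁺ (𝕊⁺ s)
≼-reflects-Iter𝕊⇒ (≼-atoms _ bs) (𝕊⁺ s) = ⊥-elim (∏-≢-Iter𝕊⇒ bs s)
≼-reflects-Iter𝕊⇒ (≼-cong-S P≼X) (𝕊⁺ s) with ≼-reflects-Iter𝕊⇒ P≼X s
... | _ , _ , sP = _ , _ , 𝕊⁺ sP
≼-reflects-Iter𝕊⇒ (≼-⇒ _ _ _ _) 𝕊⁰ = _ , _ , 𝕊⁰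

≼-reflects-⇒ : ∀ {P C D} → P ≼ (C ⇒ D) → ∃₂ λ A B → P ≡ (A ⇒ B)
≼-reflects-⇒ ≼-refl = _ , _ , refl
≼-reflects-⇒ (≼-trans _ P≼M M≼X) with ≼-reflects-⇒ M≼X
... | _ , _ , refl = ≼-reflects-⇒ P≼M
≼-reflects-⇒ (≼-⇒ _ _ _ _) = _ , _ , refl

≼-preserves-Iter𝕊⊗ : ∀ {P X A B} → P ≼ X → Iter𝕊 (A ⊗ B) P →
  ∃₂ λ A′ B′ → Iter𝕊 (A′ ⊗ B′) X
≼-preserves-Iter𝕊⊗ ≼-refl s = _ , _ , s
≼-preserves-Iter𝕊⊗ (≼-trans _ P≼M M≼X) s with ≼-preserves-Iter𝕊⊗ P≼M s
... | _ , _ , sM = ≼-preserves-Iter𝕊⊗ M≼X sM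
≼-preserves-Iter𝕊⊗ ≼-S s = _ , _ , 𝕊⁺ s
≼-preserves-Iter𝕊⊗ ≼-SS (𝕊⁺ (𝕊⁺ s)) = _ , _ , 𝕊⁺ s
≼-preserves-Iter𝕊⊗ (≼-atoms as bs) s with ∏-Iter𝕊⊗ as bs s
... | _ , _ , sX = _ , _ , 𝕊⁺ sX
≼-preserves-Iter𝕊⊗ (≼-cong-S P≼X) (𝕊⁺ s) with ≼-preserves-Iter𝕊⊗ P≼X s
... | _ , _ , sX = _ , _ , 𝕊⁺ sX
≼-preserves-Iter𝕊⊗ (≼-⊗ _ _ _ _ _ _) _ = _ , _ , 𝕊⁰
≼-preserves-Iter𝕊⊗ ≼-assocˡ _ = _ , _ , 𝕊⁰
≼-preserves-Iter𝕊⊗ ≼-assocʳ _ = _ , _ , 𝕊⁰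

≼-preserves-𝕊 : ∀ {P X} → P ≼ X → ∃ (λ A → P ≡ 𝕊 A) → ∃ λ C → X ≡ 𝕊 C
≼-preserves-𝕊 ≼-refl isS = isS
≼-preserves-𝕊 (≼-trans _ P≼M M≼X) isS = ≼-preserves-𝕊 M≼X (≼-preserves-𝕊 P≼M isS)
≼-preserves-𝕊 ≼-S _ = _ , refl
≼-preserves-𝕊 ≼-SS _ = _ , refl
≼-preserves-𝕊 (≼-atoms _ _) _ = _ , refl
≼-preserves-𝕊 (≼-cong-S _) _ = _ , refl
≼-preserves-𝕊 (≼-⇒ _ _ _ _) (_ , ())
≼-preserves-𝕊 (≼-⊗ _ _ _ _ _ _) (_ , ())
≼-preserves-𝕊 ≼-assocˡ (_ , ())
≼-preserves-𝕊 ≼-assocʳ (_ , ())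

#×-∏ : ∀ {n} (as : Vec Atom (suc n)) → #× (∏ as) ≡ n
#×-∏ (a ∷ [])     = refl
#×-∏ (a ∷ b ∷ as) = cong suc (#×-∏ (b ∷ as))

#×-assoc : ∀ A B C → #× (A ⊗ (B ⊗ C)) ≡ #× ((A ⊗ B) ⊗ C)
#×-assoc A B C = cong suc (begin
  #× A + suc (#× B + #× C)  ≡⟨ +-suc (#× A) (#× B + #× C) ⟩
  suc (#× A + (#× B + #× C)) ≡⟨ cong suc (sym (+-assoc (#× A) (#× B) (#× C))) ⟩
  suc (#× A + #× B + #× C)   ∎)
  where open ≡-Reasoning

≼-preserves-#× : ∀ {A B} → A ≼ B → #× A ≡ #× B
≼-preserves-#× ≼-refl = refl
≼-preserves-#× (≼-trans _ A≼M M≼B) = trans (≼-preserves-#× A≼M) (≼-preserves-#× M≼B)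
≼-preserves-#× ≼-S = refl
≼-preserves-#× ≼-SS = refl
≼-preserves-#× (≼-atoms as bs) = trans (#×-∏ as) (sym (#×-∏ bs))
≼-preserves-#× (≼-cong-S A≼B) = ≼-preserves-#× A≼B
≼-preserves-#× (≼-⇒ _ _ A≼B Ψ₁≼Ψ₂) =
  cong₂ _+_ (sym (≼-preserves-#× Ψ₁≼Ψ₂)) (≼-preserves-#× A≼B)
≼-preserves-#× (≼-⊗ _ _ _ _ Ψ₁≼Ψ₂ Ψ₃≼Ψ₄) =
  cong suc (cong₂ _+_ (≼-preserves-#× Ψ₁≼Ψ₂) (≼-preserves-#× Ψ₃≼Ψ₄))
≼-preserves-#× (≼-assocˡ {A} {B} {C}) = #×-assoc A B C
≼-preserves-#× (≼-assocʳ {A} {B} {C}) = sym (#×-assoc A B C)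

⇒-≼-⇒⁻ : ∀ {A B C D} → IsType (C ⇒ D) → (A ⇒ B) ≼ (C ⇒ D) → (C ≼ A) × (B ≼ D)
⇒-≼-⇒⁻ w A⇒B≼C⇒D with ≼-preserves-Iter𝕊⇒ w A⇒B≼C⇒D 𝕊⁰
... | _ , _ , 𝕊⁰ , C≼A , B≼D = C≼A , B≼D

⇒-≼-𝕊⇒⁻ : ∀ {A B C D} → IsType (C ⇒ D) → (A ⇒ B) ≼ 𝕊 (C ⇒ D) → (C ≼ A) × (B ≼ D)
⇒-≼-𝕊⇒⁻ w A⇒B≼SC⇒D with ≼-preserves-Iter𝕊⇒ (t-S w) A⇒B≼SC⇒D 𝕊⁰
... | _ , _ , 𝕊⁺ 𝕊⁰ , C≼A , B≼D = C≼A , B≼D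

𝕊⇒-≼-𝕊⇒⁻ : ∀ {A B C D} → IsType (C ⇒ D) → 𝕊 (A ⇒ B) ≼ 𝕊 (C ⇒ D) → (C ≼ A) × (B ≼ D)
𝕊⇒-≼-𝕊⇒⁻ w SA⇒B≼SC⇒D with ≼-preserves-Iter𝕊⇒ (t-S w) SA⇒B≼SC⇒D (𝕊⁺ 𝕊⁰)
... | _ , _ , 𝕊⁺ 𝕊⁰ , C≼A , B≼D = C≼A , B≼D

-- B is itself an 𝕊-type, hence B ≈ 𝕊 B, and C := B is the witness.
𝕊-≼⁻ : ∀ {A B} → IsType A → IsType B → 𝕊 A ≼ B →
  Σ Ty λ C → IsType C × (B ≈ 𝕊 C) × (A ≼ C)
𝕊-≼⁻ wA wB SA≼B with ≼-preserves-𝕊 SA≼B (_ , refl)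
... | _ , refl = _ , wB , (≼-S , ≼-SS) , ≼-trans (t-S wA) ≼-S SA≼B

⊗-≼⁻ : ∀ {Ψ₁ Ψ₂ A} → IsType A → (Ψ₁ ⊗ Ψ₂) ≼ A →
  Σ Ty λ Ψ₃ → Σ Ty λ Ψ₄ → IsQubit Ψ₃ × IsQubit Ψ₄ ×
    ((A ≈ 𝕊 (Ψ₃ ⊗ Ψ₄)) ⊎ (A ≈ (Ψ₃ ⊗ Ψ₄)))
⊗-≼⁻ w Ψ₁⊗Ψ₂≼A with ≼-preserves-Iter𝕊⊗ Ψ₁⊗Ψ₂≼A 𝕊⁰
... | _ , _ , 𝕊⁰ = _ , _ , proj₁ (IsType-⊗⁻ w) , proj₂ (IsType-⊗⁻ w) , inj₂ (≼-refl , ≼-refl)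
... | _ , _ , 𝕊⁺ s = _ , _ , proj₁ w′ , proj₂ w′ , inj₁ (𝕊-Iter𝕊-≈ s w)
  where w′ = IsType-⊗⁻ (IsType-Iter𝕊⁻ s (IsType-𝕊⁻ w))

≼-⇒⁻ : ∀ {A Ψ C} → IsType A → A ≼ (Ψ ⇒ C) →
  Σ Ty λ Ψ′ → Σ Ty λ D → IsQubit Ψ′ × IsType D × (A ≈ (Ψ′ ⇒ D))
≼-⇒⁻ w A≼Ψ⇒C with ≼-reflects-⇒ A≼Ψ⇒C
... | _ , _ , refl = _ , _ , proj₁ (IsType-⇒⁻ w) , proj₂ (IsType-⇒⁻ w) , ≼-refl , ≼-refl

𝕊-≼-𝕊⇒⁻ : ∀ {A Ψ C} → IsType A → 𝕊 A ≼ 𝕊 (Ψ ⇒ C) →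
  Σ Ty λ Ψ′ → Σ Ty λ D → IsQubit Ψ′ × IsType D × (𝕊 A ≈ 𝕊 (Ψ′ ⇒ D))
𝕊-≼-𝕊⇒⁻ w SA≼SΨ⇒C with ≼-reflects-Iter𝕊⇒ SA≼SΨ⇒C (𝕊⁺ 𝕊⁰)
... | _ , _ , 𝕊⁺ s = _ , _ , proj₁ w′ , proj₂ w′ , 𝕊-Iter𝕊-≈ s (t-S w)
  where w′ = IsType-⇒⁻ (IsType-Iter𝕊⁻ s w)

lemma2 :
    (∀ {A B C D} → IsQubit A → IsType B → IsQubit C → IsType D →
      (A ⇒ B) ≼ (C ⇒ D) → (C ≼ A) × (B ≼ D))
    × (∀ {A B C D} → IsQubit A → IsType B → IsQubit C → IsType D →
      (A ⇒ B) ≼ 𝕊 (C ⇒ D) → (C ≼ A) × (B ≼ D))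
    × (∀ {A B} → IsType A → IsType B →
      𝕊 A ≼ B → Σ Ty λ C → IsType C × (B ≈ 𝕊 C) × (A ≼ C))
    × (∀ {Ψ₁ Ψ₂ A} → IsQubit Ψ₁ → IsQubit Ψ₂ → IsType A →
      (Ψ₁ ⊗ Ψ₂) ≼ A →
      Σ Ty λ Ψ₃ → Σ Ty λ Ψ₄ → IsQubit Ψ₃ × IsQubit Ψ₄ ×
        ((A ≈ 𝕊 (Ψ₃ ⊗ Ψ₄)) ⊎ (A ≈ (Ψ₃ ⊗ Ψ₄))))
    × (∀ {A B} → IsType A → IsType B → A ≼ B → #× A ≡ #× B)
    × (∀ {A Ψ₁ C} → IsType A → IsQubit Ψ₁ → IsType C →
      A ≼ (Ψ₁ ⇒ C) →
      Σ Ty λ Ψ₂ → Σ Ty λ D → IsQubit Ψ₂ × IsType D × (A ≈ (Ψ₂ ⇒ D)))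
    × (∀ {A Ψ₁ C} → IsType A → IsQubit Ψ₁ → IsType C →
      𝕊 A ≼ 𝕊 (Ψ₁ ⇒ C) →
      Σ Ty λ Ψ₂ → Σ Ty λ D → IsQubit Ψ₂ × IsType D × (𝕊 A ≈ 𝕊 (Ψ₂ ⇒ D)))
    × (∀ {Ψ₁ Ψ₂ A B} → IsQubit Ψ₁ → IsQubit Ψ₂ → IsType A → IsType B →
      𝕊 (Ψ₁ ⇒ A) ≼ 𝕊 (Ψ₂ ⇒ B) → (Ψ₂ ≼ Ψ₁) × (A ≼ B))
lemma2 =
    (λ _ _ qC tD → ⇒-≼-⇒⁻ (t-⇒ qC tD))
  , (λ _ _ qC tD → ⇒-≼-𝕊⇒⁻ (t-⇒ qC tD))
  , 𝕊-≼⁻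
  , (λ _ _ → ⊗-≼⁻)
  , (λ _ _ → ≼-preserves-#×)
  , (λ w _ _ → ≼-⇒⁻ w)
  , (λ w _ _ → 𝕊-≼-𝕊⇒⁻ w)
  , (λ _ q₂ _ tB → 𝕊⇒-≼-𝕊⇒⁻ (t-⇒ q₂ tB))
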